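{- Let $n>1$, let $1\leq m<n$, and let $f,g$ be $Q(m)$-rankings for $\mathcal{FB}_n$. Then there exists a word $w_{f,g}\in\Sigma_n^*$ such that: (i) for all $p,q\in S'_n$: $p\xrightarrow{w_{f,g}}q$ iff ($f(p)>g(q)$ or $f(p)=g(q)$ is odd); (ii) for all $p,q\in S'_n$: $p\xrightarrow[F_n]{w_{f,g}}q$ iff $f(p)>g(q)$; (iii) for all $p,q\in S_n$: if $p\xrightarrow{w_{f,g}}q$ then $p\notin F_n$ and $q\notin F_n$.
   Context: For $n>1$, $\mathcal{FB}_n=(\Sigma_n,S_n,I_n,\Delta_n,F_n)$ is the full Büchi automaton with state set $S_n=\{s_0,\dots,s_{n-2},s_f\}$ ($n$ distinct states), $I_n=S'_n=\{s_0,\dots,s_{n-2}\}$, $F_n=\{s_f\}$, alphabet $\Sigma_n=\mathcal{P}(S_n\times S_n)$ (all binary relations on $S_n$) and transitions $\langle p,a,q\rangle\in\Delta_n$ iff $\langle p,q\rangle\in a$. For a finite word $w=a(0)\cdots a(l-1)$, a finite run from $p$ to $q$ over $w$ is a state sequence $\rho(0)\cdots\rho(l)$ with $\rho(0)=p$, $\rho(l)=q$ and $\langle\rho(i),a(i),\rho(i+1)\rangle\in\Delta_n$ for all $i<l$; write $p\xrightarrow{w}q$ if such a run exists, and $p\xrightarrow[T]{w}q$ if such a run exists that visits $T$, i.e. $\rho(i)\in T$ for some $0\leq i\leq l$. For $1\leq m<n$, a $Q(m)$-ranking is a function $h:S'_n\to\{0,1,\dots,2m-1\}$ such that every odd number $1,3,\dots,2m-1$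 is a value of $h$ (in the paper it is a partial function on $S_n$, undefined exactly at $s_f$). -}

module Defs where

open import Data.Nat using (ℕ; zero; suc; _+_; _*_; _<_; _≤_; _>_)
open import Data.Nat.Properties using ()
open import Data.Fin using (Fin; fromℕ; inject₁)
open import Data.Bool using (Bool; true; false; T)
open import Data.List using (List; []; _∷_; length)
open import Data.Vec using (Vec; []; _∷_; lookup; head; last)
open import Data.Product using (Σ; ∃; ∃-syntax; _×_; _,_)
open import Data.Sum using (_⊎_)
open import Relation.Binary.PropositionalEquality using (_≡_)
open import Relation.Nullary using (¬_)

-- The full Büchi automaton FB_n with n = suc k (n > 1 means k ≥ 1).
-- States: Fin n.  s_i = inject₁ i for i : Fin k (i = 0..n-2),  s_f = fromℕ k.

State : ℕ → Set
State k = Fin (suc k)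

s′ : ∀ {k} → Fin k → State k
s′ = inject₁

s-f : ∀ {k} → State k
s-f {k} = fromℕ k

InF : ∀ {k} → State k → Set
InF {k} p = p ≡ s-f {k}

-- Alphabet Σ_n = P(S_n × S_n): all binary relations on S_n (as characteristic functions)
Letter : ℕ → Set
Letter k = State k → State k → Bool

Word : ℕ → Set
Word k = List (Letter k)

Δ : ∀ {k} → State k → Letter k → State k → Set
Δ p a q = T (a p q)

-- ρ is a valid sequence of states for word w:  ρ(i) --a(i)--> ρ(i+1)
-- Runs are given as state lists consumed alongside the word.
data Run {k : ℕ} : Word k → State k → State k → List (State k) → Set where
  done : ∀ {p} → Run [] p p (p ∷ [])
  step : ∀ {a w p r q ρ} → Δ p a r → Run w r q ρ → Run (a ∷ w) p q (p ∷ ρ)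

_⟶[_]_ : ∀ {k} → State k → Word k → State k → Set
p ⟶[ w ] q = ∃[ ρ ] Run w p q ρ

data VisitsF {k : ℕ} : List (State k) → Set where
  here  : ∀ {p ρ} → InF p → VisitsF (p ∷ ρ)
  there : ∀ {p ρ} → VisitsF ρ → VisitsF (p ∷ ρ)

_⟶F[_]_ : ∀ {k} → State k → Word k → State k → Set
p ⟶F[ w ] q = ∃[ ρ ] (Run w p q ρ × VisitsF ρ)

Odd : ℕ → Set
Odd x = ∃[ j ] x ≡ suc (2 * j)

record QRanking (k m : ℕ) : Set where
  field
    rank    : Fin k → ℕ
    bounded : ∀ p → rank p < 2 * m
    onto-odd : ∀ j → j < m → ∃[ p ] rank p ≡ suc (2 * j)
open QRanking public

module Submission where

-- Every letter used never loops at s_f, so it is given by three parts: its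
-- restriction to S'×S', its edges S'→s_f and its edges s_f→S'.  For a
-- valuation V : S' → ℕ and a threshold t, the two-letter "gate" at t keeps
-- every state of S' fixed, but also lets a state of value > t pass through
-- s_f to any state of value ≤ t.  The phase  phase V N  is the sequence of
-- gates at N-1, …, 1, 0: along it a run from s'c reaches exactly the s'd with
-- V d ≤ V c, and it can visit s_f exactly when V d < V c (given V c ≤ N).
-- The witness is  phase f N · Z · phase g N,  where the middle letter Z
-- relates c to d iff f c ≽ g d.  Soundness follows from monotonicity of the
-- phases; for f p > g q the F-visiting run crosses s_f inside the f-phase
-- (g q odd: jump to a state of f-value g q) or inside the g-phase (g q even:
-- jump from a state of g-value g q + 1); here surjectivity of the rankings
-- onto the odd numbers below 2m is used.

open import Defs
open import Data.Nat using (ℕ; zero; suc; _≤_; _<_; _>_; _*_; _<?_; _≤?_)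
open import Data.Nat.Properties
  using (_≟_; ≤-refl; ≤-trans; <⇒≤; ≤-<-trans; <-≤-trans; ≤-pred; n<1+n;
         m≤n⇒m<n∨m≡n; *-suc; *-cancelˡ-<; suc-injective)
open import Data.Fin using (Fin) renaming (_≟_ to _≟ᶠ_)
open import Data.Fin.Properties using (inject₁-injective; fromℕ≢inject₁)
open import Data.Fin.Relation.Unary.Top using (View; view; ‵fromℕ; ‵inj₁; view-inject₁; view-fromℕ)
open import Data.Bool using (Bool; false; T)
open import Data.List using (List; []; _∷_; _++_)
open import Data.Product using (Σ; ∃-syntax; _×_; _,_; proj₂)
open import Data.Sum using (_⊎_; inj₁; inj₂; map₁)
open import Data.Empty using (⊥-elim)
open import Function.Bundles using (_⇔_; mk⇔)
open import Relation.Binary.PropositionalEquality using (_≡_; refl; sym; trans; cong; subst)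
open import Relation.Nullary using (¬_; Dec; yes; no)
open import Relation.Nullary.Decidable using (⌊_⌋; toWitness; fromWitness; map′; _⊎-dec_; _×-dec_)

private
  variable
    k : ℕ

odd-2+ : ∀ {n} → Odd n → Odd (suc (suc n))
odd-2+ (j , e) = suc j , trans (cong (λ x → suc (suc x)) e) (cong suc (sym (*-suc 2 j)))

odd-2- : ∀ {n} → Odd (suc (suc n)) → Odd n
odd-2- (suc j , e) = j , suc-injective (suc-injective (trans e (cong suc (*-suc 2 j))))

Odd? : ∀ n → Dec (Odd n)
Odd? zero = no λ ()
Odd? (suc zero) = yes (0 , refl)
Odd? (suc (suc n)) = map′ odd-2+ odd-2- (Odd? n)

parity : ∀ n → Odd n ⊎ Odd (suc n)
parity zero = inj₂ (0 , refl)
parity (suc n) with parity n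
... | inj₁ odd-n = inj₂ (odd-2+ odd-n)
... | inj₂ odd-1+n = inj₁ odd-1+n

_≽_ : ℕ → ℕ → Set
a ≽ b = (a > b) ⊎ ((a ≡ b) × Odd a)

_≽?_ : ∀ a b → Dec (a ≽ b)
a ≽? b = (b <? a) ⊎-dec ((a ≟ b) ×-dec Odd? a)

≽⇒≥ : ∀ {a b} → a ≽ b → b ≤ a
≽⇒≥ (inj₁ b<a) = <⇒≤ b<a
≽⇒≥ (inj₂ (refl , _)) = ≤-refl

odd-≽ : ∀ {a b} → b ≤ a → Odd b → a ≽ b
odd-≽ b≤a odd-b with m≤n⇒m<n∨m≡n b≤a
... | inj₁ b<a = inj₁ b<a
... | inj₂ refl = inj₂ (refl , odd-b)

≽-mono : ∀ {a a′ b′ b} → a′ ≤ a → a′ ≽ b′ → b ≤ b′ → a ≽ b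
≽-mono a′≤a (inj₁ b′<a′) b≤b′ = inj₁ (≤-<-trans b≤b′ (<-≤-trans b′<a′ a′≤a))
≽-mono a′≤a (inj₂ (refl , odd-a′)) b≤b′ with m≤n⇒m<n∨m≡n a′≤a | m≤n⇒m<n∨m≡n b≤b′
... | inj₁ a′<a | _ = inj₁ (≤-<-trans b≤b′ a′<a)
... | inj₂ refl | inj₁ b<b′ = inj₁ b<b′
... | inj₂ refl | inj₂ refl = inj₂ (refl , odd-a′)

odd-value : ∀ {m x} (h : QRanking k m) → Odd x → x ≤ 2 * m → ∃[ v ] rank h v ≡ x
odd-value {m = m} h (j , refl) x≤2m = onto-odd h j (*-cancelˡ-< 2 j m x≤2m)

s′∉F : (c : Fin k) → ¬ InF (s′ c)
s′∉F c e = fromℕ≢inject₁ (sym e)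

visits-start : ∀ {w : Word k} {p q ρ} → Run w p q ρ → InF p → VisitsF ρ
visits-start done e = here e
visits-start (step _ _) e = here e

run-split : ∀ (w₁ : Word k) {w₂ p q ρ} → Run (w₁ ++ w₂) p q ρ →
  Σ (State k) λ r → Σ (List (State k)) λ ρ₁ → Σ (List (State k)) λ ρ₂ →
    Run w₁ p r ρ₁ × Run w₂ r q ρ₂ × (VisitsF ρ → VisitsF ρ₁ ⊎ VisitsF ρ₂)
run-split [] R = _ , _ , _ , done , R , inj₂
run-split (a ∷ w₁) (step h R) with run-split w₁ R
... | r , ρ₁ , ρ₂ , R₁ , R₂ , visits =
  r , _ , ρ₂ , step h R₁ , R₂ , λ { (here e) → inj₁ (here e) ; (there v) → map₁ there (visits v) }

run-join : ∀ {w₁ w₂ : Word k} {p r q ρ₁ ρ₂} → Run w₁ p r ρ₁ → Run w₂ r q ρ₂ →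
  ∃[ ρ ] (Run (w₁ ++ w₂) p q ρ × (VisitsF ρ₁ ⊎ VisitsF ρ₂ → VisitsF ρ))
run-join done R₂ = _ , R₂ , λ { (inj₁ (here e)) → visits-start R₂ e ; (inj₂ v) → v }
run-join (step h R₁) R₂ with run-join R₁ R₂
... | ρ , R , visits = _ , step h R ,
  λ { (inj₁ (here e)) → here e ; (inj₁ (there v)) → there (visits (inj₁ v)) ; (inj₂ v) → there (visits (inj₂ v)) }

-- Letters without a loop at s_f, described by their three parts: the
-- relation r on S', the edges a from S' into s_f and the edges b out of s_f.

none : Fin k → Bool
none _ = false

module Shaped (r : Fin k → Fin k → Bool) (a b : Fin k → Bool) where

  shape : {x y : State k} → View x → View y → Bool
  shape (‵inj₁ {i = c} _) (‵inj₁ {i = d} _) = r c d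
  shape (‵inj₁ {i = c} _) ‵fromℕ = a c
  shape ‵fromℕ (‵inj₁ {i = d} _) = b d
  shape ‵fromℕ ‵fromℕ = false

  letter : Letter k
  letter x y = shape (view x) (view y)

  s′s′-step : ∀ c d → T (r c d) → Δ (s′ c) letter (s′ d)
  s′s′-step c d rewrite view-inject₁ c | view-inject₁ d = λ t → t

  s′F-step : ∀ c → T (a c) → Δ (s′ c) letter s-f
  s′F-step c rewrite view-inject₁ c | view-fromℕ k = λ t → t

  Fs′-step : ∀ d → T (b d) → Δ s-f letter (s′ d)
  Fs′-step d rewrite view-inject₁ d | view-fromℕ k = λ t → t

  data StepShape (x y : State k) : Set where
    s′→s′ : ∀ c d → x ≡ s′ c → y ≡ s′ d → T (r c d) → StepShape x y
    s′→F : ∀ c → x ≡ s′ c → InF y → T (a c) → StepShape x y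
    F→s′ : ∀ d → InF x → y ≡ s′ d → T (b d) → StepShape x y

  shape-inversion : ∀ {x y} (vx : View x) (vy : View y) → T (shape vx vy) → StepShape x y
  shape-inversion (‵inj₁ {i = c} _) (‵inj₁ {i = d} _) t = s′→s′ c d refl refl t
  shape-inversion (‵inj₁ {i = c} _) ‵fromℕ t = s′→F c refl refl t
  shape-inversion ‵fromℕ (‵inj₁ {i = d} _) t = F→s′ d refl refl t

  step-shape : ∀ x y → Δ x letter y → StepShape x y
  step-shape x y = shape-inversion (view x) (view y)

  from-s′ : ∀ c y → Δ (s′ c) letter y → (∃[ d ] (y ≡ s′ d × T (r c d))) ⊎ (InF y × T (a c))
  from-s′ c y h with step-shape (s′ c) y h
  ... | s′→s′ _ d e refl t with inject₁-injective e
  ...   | refl = inj₁ (d , refl , t)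
  from-s′ c y h | s′→F _ e refl t with inject₁-injective e
  ...   | refl = inj₂ (refl , t)
  from-s′ c y h | F→s′ _ e _ _ = ⊥-elim (s′∉F c e)

  from-F : ∀ y → Δ s-f letter y → ∃[ d ] (y ≡ s′ d × T (b d))
  from-F y h with step-shape s-f y h
  ... | s′→s′ c _ e _ _ = ⊥-elim (s′∉F c (sym e))
  ... | s′→F c e _ _ = ⊥-elim (s′∉F c (sym e))
  ... | F→s′ d _ e t = d , e , t

  no-exit : (∀ d → ¬ T (b d)) → ∀ x y → Δ x letter y → ¬ InF x
  no-exit no-b x y h refl with from-F y h
  ... | d , _ , t = no-b d t

  no-entry : (∀ c → ¬ T (a c)) → ∀ x y → Δ x letter y → ¬ InF y
  no-entry no-a x y h refl with step-shape x s-f h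
  ... | s′→s′ _ d _ e _ = s′∉F d (sym e)
  ... | s′→F c _ _ t = no-a c t
  ... | F→s′ d _ e _ = s′∉F d (sym e)

module Phase (V : Fin k → ℕ) where

  identity : Fin k → Fin k → Bool
  identity c d = ⌊ c ≟ᶠ d ⌋

  module Enter (t : ℕ) = Shaped identity (λ c → ⌊ t <? V c ⌋) none
  module Leave (t : ℕ) = Shaped identity none (λ d → ⌊ V d ≤? t ⌋)

  phase : ℕ → Word k
  phase zero = []
  phase (suc n) = Enter.letter n ∷ Leave.letter n ∷ phase n

  gate : ∀ t c r y → Δ (s′ c) (Enter.letter t) r → Δ r (Leave.letter t) y →
    (r ≡ s′ c × y ≡ s′ c) ⊎ (InF r × ∃[ d ] (y ≡ s′ d × V d < V c))
  gate t c r y h₁ h₂ with Enter.from-s′ t c r h₁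
  ... | inj₂ (refl , t<Vc) with Leave.from-F t y h₂
  ...   | d , refl , Vd≤t = inj₂ (refl , d , refl , ≤-<-trans (toWitness Vd≤t) (toWitness t<Vc))
  gate t c r y h₁ h₂ | inj₁ (_ , refl , same) with toWitness same
  ...   | refl with Leave.from-s′ t c y h₂
  ...     | inj₁ (_ , refl , same′) with toWitness same′
  ...       | refl = inj₁ (refl , refl)
  gate t c r y h₁ h₂ | inj₁ (_ , refl , _) | refl | inj₂ (_ , ())

  phase-descends : ∀ n c {y ρ} → Run (phase n) (s′ c) y ρ →
    ∃[ d ] (y ≡ s′ d × V d ≤ V c × (VisitsF ρ → V d < V c))
  phase-descends zero c done = c , refl , ≤-refl , λ { (here e) → ⊥-elim (s′∉F c e) }
  phase-descends (suc n) c (step {r = r₁} h₁ (step {r = r₂} h₂ R)) with gate n c r₁ r₂ h₁ h₂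
  ... | inj₁ (refl , refl) with phase-descends n c R
  ...   | d , refl , Vd≤Vc , strict = d , refl , Vd≤Vc ,
    λ { (here e) → ⊥-elim (s′∉F c e) ; (there (here e)) → ⊥-elim (s′∉F c e) ; (there (there v)) → strict v }
  phase-descends (suc n) c (step h₁ (step h₂ R)) | inj₂ (refl , d , refl , Vd<Vc) with phase-descends n d R
  ...   | e , refl , Ve≤Vd , _ = e , refl , <⇒≤ Ve<Vc , λ _ → Ve<Vc
    where Ve<Vc = ≤-<-trans Ve≤Vd Vd<Vc

  phase-stay : ∀ n c → ∃[ ρ ] Run (phase n) (s′ c) (s′ c) ρ
  phase-stay zero c = _ , done
  phase-stay (suc n) c =
    _ , step (Enter.s′s′-step n c c (fromWitness refl))
          (step (Leave.s′s′-step n c c (fromWitness refl)) (proj₂ (phase-stay n c)))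

  phase-cross : ∀ n {t} c d → t < n → t < V c → V d ≤ t →
    ∃[ ρ ] (Run (phase n) (s′ c) (s′ d) ρ × VisitsF ρ)
  phase-cross (suc n) {t} c d t<1+n t<Vc Vd≤t with m≤n⇒m<n∨m≡n (≤-pred t<1+n)
  ... | inj₂ refl =
    _ , step (Enter.s′F-step t c (fromWitness t<Vc))
          (step (Leave.Fs′-step t d (fromWitness Vd≤t)) (proj₂ (phase-stay t d))) ,
    there (here refl)
  ... | inj₁ t<n with phase-cross n c d t<n t<Vc Vd≤t
  ...   | ρ , R , v =
    _ , step (Enter.s′s′-step n c c (fromWitness refl))
          (step (Leave.s′s′-step n c c (fromWitness refl)) R) ,
    there (there v)

  phase-from-F : ∀ n {x y ρ} → Run (phase n) x y ρ → InF x → InF y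
  phase-from-F zero done e = e
  phase-from-F (suc n) (step {r = r} h _) e = ⊥-elim (Enter.no-exit n (λ _ ()) _ r h e)

  phase-to-F : ∀ n {x y ρ} → Run (phase n) x y ρ → InF y → InF x
  phase-to-F zero done e = e
  phase-to-F (suc n) (step _ (step {p = r₁} {r = r₂} h₂ R)) e =
    ⊥-elim (Leave.no-entry n (λ _ ()) r₁ r₂ h₂ (phase-to-F n R e))

module Witness (f g : Fin k → ℕ) (N : ℕ) where
  open Phase f using () renaming (phase to f-phase; phase-descends to f-descends;
                                  phase-stay to f-stay; phase-cross to f-cross; phase-from-F to f-from-F)
  open Phase g using () renaming (phase to g-phase; phase-descends to g-descends;
                                  phase-stay to g-stay; phase-cross to g-cross; phase-to-F to g-to-F)

  module Middle = Shaped (λ c d → ⌊ f c ≽? g d ⌋) none none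

  word : Word k
  word = f-phase N ++ (Middle.letter ∷ g-phase N)

  word-descends : ∀ {p y ρ} → Run word (s′ p) y ρ →
    ∃[ q ] (y ≡ s′ q × f p ≽ g q × (VisitsF ρ → g q < f p))
  word-descends {p} R with run-split (f-phase N) R
  ... | _ , ρ₁ , ρ₂ , R₁ , step {r = r} h R₃ , visits with f-descends N p R₁
  ...   | c , refl , fc≤fp , strict₁ with Middle.from-s′ c r h
  ...     | inj₂ (_ , ())
  ...     | inj₁ (d , refl , fc≽gd) with g-descends N d R₃
  ...       | q , refl , gq≤gd , strict₃ =
    q , refl , ≽-mono fc≤fp (toWitness fc≽gd) gq≤gd , λ v → strict (visits v)
    where
    strict : VisitsF ρ₁ ⊎ VisitsF ρ₂ → g q < f p
    strict (inj₁ v) = ≤-<-trans gq≤gd (≤-<-trans (≽⇒≥ (toWitness fc≽gd)) (strict₁ v))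
    strict (inj₂ (here e)) = ⊥-elim (s′∉F c e)
    strict (inj₂ (there v)) = <-≤-trans (strict₃ v) (≤-trans (≽⇒≥ (toWitness fc≽gd)) fc≤fp)

  word-reach : ∀ {p q} → s′ p ⟶[ word ] s′ q → f p ≽ g q
  word-reach (_ , R) with word-descends R
  ... | _ , e , fp≽gq , _ with inject₁-injective e
  ...   | refl = fp≽gq

  word-reachF : ∀ {p q} → s′ p ⟶F[ word ] s′ q → g q < f p
  word-reachF (_ , R , v) with word-descends R
  ... | _ , e , _ , strict with inject₁-injective e
  ...   | refl = strict v

  word-run : ∀ {p c d q ρ₁ ρ₃} → Run (f-phase N) (s′ p) (s′ c) ρ₁ → f c ≽ g d →
    Run (g-phase N) (s′ d) (s′ q) ρ₃ →
    ∃[ ρ ] (Run word (s′ p) (s′ q) ρ × (VisitsF ρ₁ ⊎ VisitsF ρ₃ → VisitsF ρ))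
  word-run {c = c} {d} R₁ fc≽gd R₃ with run-join R₁ (step (Middle.s′s′-step c d (fromWitness fc≽gd)) R₃)
  ... | ρ , R , visits = ρ , R , λ { (inj₁ v) → visits (inj₁ v) ; (inj₂ v) → visits (inj₂ (there v)) }

  word-complete : ∀ {p q} → f p ≽ g q → s′ p ⟶[ word ] s′ q
  word-complete {p} {q} fp≽gq with word-run (proj₂ (f-stay N p)) fp≽gq (proj₂ (g-stay N q))
  ... | ρ , R , _ = ρ , R

  -- For odd g q it crosses in the
  -- f-phase to a state v with f v = g q; for even g q it crosses in the
  -- g-phase from a state u with g u = g q + 1.
  word-complete-F : (∀ {x} → Odd x → x ≤ N → ∃[ v ] f v ≡ x) →
                    (∀ {x} → Odd x → x ≤ N → ∃[ u ] g u ≡ x) →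
                    (∀ q → g q < N) →
                    ∀ {p q} → g q < f p → s′ p ⟶F[ word ] s′ q
  word-complete-F f-odd g-odd g<N {p} {q} gq<fp with parity (g q)
  ... | inj₁ odd-gq with f-odd odd-gq (<⇒≤ (g<N q))
  ...   | v , fv≡gq with f-cross N p v (g<N q) gq<fp (subst (_≤ g q) (sym fv≡gq) ≤-refl)
  ...     | ρ₁ , R₁ , v₁ with word-run R₁ (odd-≽ (subst (g q ≤_) (sym fv≡gq) ≤-refl) odd-gq) (proj₂ (g-stay N q))
  ...       | ρ , R , visits = ρ , R , visits (inj₁ v₁)
  word-complete-F f-odd g-odd g<N {p} {q} gq<fp | inj₂ odd-1+gq with g-odd odd-1+gq (g<N q)
  ...   | u , gu≡1+gq with g-cross N u q (g<N q) (subst (g q <_) (sym gu≡1+gq) (n<1+n (g q))) ≤-refl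
  ...     | ρ₃ , R₃ , v₃ with word-run (proj₂ (f-stay N p)) fp≽gu R₃
    where
    fp≽gu : f p ≽ g u
    fp≽gu = odd-≽ (subst (_≤ f p) (sym gu≡1+gq) gq<fp) (subst Odd (sym gu≡1+gq) odd-1+gq)
  ...       | ρ , R , visits = ρ , R , visits (inj₂ v₃)

  -- The middle letter neither leaves nor enters s_f, and the phases keep
  -- s_f isolated, so runs over the word avoid s_f at both ends.
  word-avoids-F : ∀ {x y ρ} → Run word x y ρ → ¬ InF x × ¬ InF y
  word-avoids-F R with run-split (f-phase N) R
  ... | r , _ , _ , R₁ , step {r = r′} h R₃ , _ =
    (λ x∈F → Middle.no-exit (λ _ ()) r r′ h (f-from-F N R₁ x∈F)) ,
    (λ y∈F → Middle.no-entry (λ _ ()) r r′ h (g-to-F N R₃ y∈F))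

lemma4p3 : (k m : ℕ) → 1 ≤ k → 1 ≤ m → m < suc k → (f g : QRanking k m) →
    ∃[ w ]
    ((∀ (p q : Fin k) → (s′ p ⟶[ w ] s′ q) ⇔ ((rank f p > rank g q) ⊎ ((rank f p ≡ rank g q) × Odd (rank f p))))
    × (∀ (p q : Fin k) → (s′ p ⟶F[ w ] s′ q) ⇔ (rank f p > rank g q))
    × (∀ (p q : State k) → p ⟶[ w ] q → ¬ InF p × ¬ InF q))
lemma4p3 k m _ _ _ f g =
  word ,
  (λ p q → mk⇔ word-reach word-complete) ,
  (λ p q → mk⇔ word-reachF (word-complete-F (odd-value f) (odd-value g) (bounded g))) ,
  λ p q (_ , R) → word-avoids-F R
  where open Witness (rank f) (rank g) (2 * m)
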